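{- Let $\Lambda$ be a restorative similarity type and $\mathfrak{M}=\langle W,R,\{P_k\}_{k\in K}\rangle$ a modally saturated Kripke model. Then for all $w\in W$ and all $\Delta\subseteq\mathcal{L}_\Lambda$: if $\Delta$ is finitely refutable in $R[w]$, then $\Delta$ is refutable in $R[w]$.
   Context: Fix a set $K$ of indices for propositional letters $p_k$. A Kripke model is $\mathfrak{M}=\langle W,R,\{P_k\}_{k\in K}\rangle$ with $W$ nonempty, $R\subseteq W\times W$, each $P_k\subseteq W$; $R[w]=\{v: wRv\}$. Consider six unary connectives $\smile,\frown,\circ_\smile,\circ_\frown,\bullet_\smile,\bullet_\frown$; a restorative similarity type is any subset $\Lambda$ of this set. $\mathcal{L}_\Lambda$ is generated by $\phi::=p_k\mid\top\mid\bot\mid\phi\wedge\phi\mid\phi\vee\phi\mid\star\phi$ ($k\in K$, $\star\in\Lambda$). Satisfaction: $w\Vdash p_k$ iff $w\in P_k$; $\top$ true everywhere, $\bot$ nowhere; $\wedge,\vee$ classical; $w\Vdash\smile\phi$ iff some $v$ with $wRv$ has $v\not\Vdash\phi$; $w\Vdash\frown\phi$ iff every $v$ with $wRv$ has $v\not\Vdash\phi$; $w\Vdash\circ_\smile\phi$ iff $w\not\Vdash\phi$ or every $v$ with $wRv$ has $v\Vdash\phi$; $w\Vdash\circ_\frown\phi$ iff $w\Vdash\phi$ or every $v$ with $wRv$ has $v\not\Vdash\phi$; $w\Vdash\bullet_\smile\phi$ iff $w\Vdash\phi$ and some $v$ with $wRv$ has $v\not\Vdash\phi$; $w\Vdash\bullet_\frown\phi$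 iff $w\not\Vdash\phi$ and some $v$ with $wRv$ has $v\Vdash\phi$. The language $\mathcal{L}_{\sim,\Box,\Diamond}$ is generated by $\phi::=p_k\mid\top\mid\bot\mid\phi\wedge\phi\mid\phi\vee\phi\mid\sim\phi\mid\Box\phi\mid\Diamond\phi$ with $w\Vdash\sim\phi$ iff $w\not\Vdash\phi$, $w\Vdash\Box\phi$ iff all $v\in R[w]$ satisfy $\phi$, $w\Vdash\Diamond\phi$ iff some $v\in R[w]$ satisfies $\phi$. For $U\subseteq W$, a set $\Delta$ of formulas is satisfiable (resp. refutable) in $U$ if some $u\in U$ satisfies (resp. fails to satisfy) every formula in $\Delta$; it is finitely satisfiable (resp. finitely refutable) in $U$ if every finite subset of $\Delta$ is satisfiable (resp. refutable) in $U$. $\mathfrak{M}$ is modally saturated if for every $w\in W$ and every $\Delta\subseteq\mathcal{L}_{\sim,\Box,\Diamond}$, if $\Delta$ is finitely satisfiable in $R[w]$ then it is satisfiable in $R[w]$. -}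

module Defs where

open import Data.Product using (Σ; _×_; _,_)
open import Data.Sum using (_⊎_)
open import Data.Unit using (⊤)
open import Data.Empty using (⊥)
open import Data.List using (List)
open import Data.List.Relation.Unary.All using (All)
open import Relation.Nullary using (¬_)

record Model (K : Set) : Set₁ where
  field
    W : Set
    inhabited : W
    R : W → W → Set
    P : K → W → Set

data Conn : Set where
  smile frown circSmile circFrown bulletSmile bulletFrown : Conn

SimType : Set₁
SimType = Conn → Set

data Form (K : Set) (Λ : SimType) : Set where
  var  : K → Form K Λ
  top  : Form K Λ
  bot  : Form K Λ
  _∧f_ : Form K Λ → Form K Λ → Form K Λ
  _∨f_ : Form K Λ → Form K Λ → Form K Λ
  op   : (c : Conn) → Λ c → Form K Λ → Form K Λ

data MForm (K : Set) : Set where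
  var  : K → MForm K
  top  : MForm K
  bot  : MForm K
  _∧m_ : MForm K → MForm K → MForm K
  _∨m_ : MForm K → MForm K → MForm K
  neg  : MForm K → MForm K
  box  : MForm K → MForm K
  dia  : MForm K → MForm K

module _ {K : Set} (M : Model K) where
  open Model M

  sat : {Λ : SimType} → W → Form K Λ → Set
  semOp : {Λ : SimType} → Conn → W → Form K Λ → Set
  sat w (var k) = P k w
  sat w top = ⊤
  sat w bot = ⊥
  sat w (φ ∧f ψ) = sat w φ × sat w ψ
  sat w (φ ∨f ψ) = sat w φ ⊎ sat w ψ
  sat w (op c _ φ) = semOp c w φ
  semOp smile w φ = Σ W λ v → R w v × ¬ sat v φ
  semOp frown w φ = ∀ v → R w v → ¬ sat v φ
  semOp circSmile w φ = ¬ sat w φ ⊎ (∀ v → R w v → sat v φ)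
  semOp circFrown w φ = sat w φ ⊎ (∀ v → R w v → ¬ sat v φ)
  semOp bulletSmile w φ = sat w φ × Σ W (λ v → R w v × ¬ sat v φ)
  semOp bulletFrown w φ = ¬ sat w φ × Σ W (λ v → R w v × sat v φ)

  msat : W → MForm K → Set
  msat w (var k) = P k w
  msat w top = ⊤
  msat w bot = ⊥
  msat w (φ ∧m ψ) = msat w φ × msat w ψ
  msat w (φ ∨m ψ) = msat w φ ⊎ msat w ψ
  msat w (neg φ) = ¬ msat w φ
  msat w (box φ) = ∀ v → R w v → msat v φ
  msat w (dia φ) = Σ W λ v → R w v × msat v φ

  -- U ⊆ W is given as a predicate; Δ ⊆ formulas as a predicate.
  -- Finite subsets of Δ are lists of formulas all belonging to Δ.
  Satisfiable : {F : Set} → (W → F → Set) → (W → Set) → (F → Set) → Set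
  Satisfiable ⊨ U Δ = Σ W λ u → U u × (∀ φ → Δ φ → ⊨ u φ)

  Refutable : {F : Set} → (W → F → Set) → (W → Set) → (F → Set) → Set
  Refutable ⊨ U Δ = Σ W λ u → U u × (∀ φ → Δ φ → ¬ ⊨ u φ)

  FinSatisfiable : {F : Set} → (W → F → Set) → (W → Set) → (F → Set) → Set
  FinSatisfiable {F} ⊨ U Δ = (Γ : List F) → All Δ Γ →
    Σ W λ u → U u × All (⊨ u) Γ

  FinRefutable : {F : Set} → (W → F → Set) → (W → Set) → (F → Set) → Set
  FinRefutable {F} ⊨ U Δ = (Γ : List F) → All Δ Γ →
    Σ W λ u → U u × All (λ φ → ¬ ⊨ u φ) Γ

  ModallySaturated : Set₁
  ModallySaturated = (w : W) (Δ : MForm K → Set) →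
    FinSatisfiable msat (R w) Δ → Satisfiable msat (R w) Δ

{-# OPTIONS --safe #-}
module Submission where

open import Defs
open import Data.Product using (Σ; _×_; _,_)
open import Data.Sum using (inj₁; inj₂)
open import Data.List using (List; []; _∷_)
open import Data.List.Relation.Unary.All using (All; []; _∷_)
open import Relation.Nullary using (¬_)
open import Relation.Binary.PropositionalEquality using (_≡_; refl)

-- Every restorative connective is definable from ∼, □ and ◇, so L_Λ translates
-- into L_{∼,□,◇} preserving truth at every world. A set Δ is then refutable
-- exactly where {∼ τ φ | φ ∈ Δ} is satisfiable, and modal saturation turns
-- finite satisfiability of the latter in R[w] into satisfiability.

translate : {K : Set} {Λ : SimType} → Form K Λ → MForm K
translate (var k)                = var k
translate top                    = top
translate bot                    = bot
translate (φ ∧f ψ)               = translate φ ∧m translate ψ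
translate (φ ∨f ψ)               = translate φ ∨m translate ψ
translate (op smile _ φ)         = dia (neg (translate φ))
translate (op frown _ φ)         = box (neg (translate φ))
translate (op circSmile _ φ)     = neg (translate φ) ∨m box (translate φ)
translate (op circFrown _ φ)     = translate φ ∨m box (neg (translate φ))
translate (op bulletSmile _ φ)   = translate φ ∧m dia (neg (translate φ))
translate (op bulletFrown _ φ)   = neg (translate φ) ∧m dia (translate φ)

NegatedTranslations : {K : Set} {Λ : SimType} → (Form K Λ → Set) → MForm K → Set
NegatedTranslations {K} {Λ} Δ ψ = Σ (Form K Λ) λ φ → Δ φ × ψ ≡ neg (translate φ)

module _ {K : Set} {Λ : SimType} {Δ : Form K Λ → Set} where

  origins : {Γ : List (MForm K)} → All (NegatedTranslations Δ) Γ → List (Form K Λ)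
  origins [] = []
  origins ((φ , _) ∷ Γ∈) = φ ∷ origins Γ∈

  origins⊆Δ : {Γ : List (MForm K)} (Γ∈ : All (NegatedTranslations Δ) Γ) →
    All Δ (origins Γ∈)
  origins⊆Δ [] = []
  origins⊆Δ ((_ , φ∈Δ , _) ∷ Γ∈) = φ∈Δ ∷ origins⊆Δ Γ∈

module _ {K : Set} {Λ : SimType} (M : Model K) where
  open Model M

  sat⇒msat-translate : ∀ w (φ : Form K Λ) → sat M w φ → msat M w (translate φ)
  msat-translate⇒sat : ∀ w (φ : Form K Λ) → msat M w (translate φ) → sat M w φ

  sat⇒msat-translate w (var k) s = s
  sat⇒msat-translate w top s = s
  sat⇒msat-translate w bot s = s
  sat⇒msat-translate w (φ ∧f ψ) (s , t) =
    sat⇒msat-translate w φ s , sat⇒msat-translate w ψ t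
  sat⇒msat-translate w (φ ∨f ψ) (inj₁ s) = inj₁ (sat⇒msat-translate w φ s)
  sat⇒msat-translate w (φ ∨f ψ) (inj₂ t) = inj₂ (sat⇒msat-translate w ψ t)
  sat⇒msat-translate w (op smile _ φ) (v , wRv , ¬s) =
    v , wRv , λ m → ¬s (msat-translate⇒sat v φ m)
  sat⇒msat-translate w (op frown _ φ) ¬all =
    λ v wRv m → ¬all v wRv (msat-translate⇒sat v φ m)
  sat⇒msat-translate w (op circSmile _ φ) (inj₁ ¬s) =
    inj₁ λ m → ¬s (msat-translate⇒sat w φ m)
  sat⇒msat-translate w (op circSmile _ φ) (inj₂ all) =
    inj₂ λ v wRv → sat⇒msat-translate v φ (all v wRv)
  sat⇒msat-translate w (op circFrown _ φ) (inj₁ s) = inj₁ (sat⇒msat-translate w φ s)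
  sat⇒msat-translate w (op circFrown _ φ) (inj₂ ¬all) =
    inj₂ λ v wRv m → ¬all v wRv (msat-translate⇒sat v φ m)
  sat⇒msat-translate w (op bulletSmile _ φ) (s , v , wRv , ¬s) =
    sat⇒msat-translate w φ s , v , wRv , λ m → ¬s (msat-translate⇒sat v φ m)
  sat⇒msat-translate w (op bulletFrown _ φ) (¬s , v , wRv , s) =
    (λ m → ¬s (msat-translate⇒sat w φ m)) , v , wRv , sat⇒msat-translate v φ s

  msat-translate⇒sat w (var k) m = m
  msat-translate⇒sat w top m = m
  msat-translate⇒sat w bot m = m
  msat-translate⇒sat w (φ ∧f ψ) (m , n) =
    msat-translate⇒sat w φ m , msat-translate⇒sat w ψ n
  msat-translate⇒sat w (φ ∨f ψ) (inj₁ m) = inj₁ (msat-translate⇒sat w φ m)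
  msat-translate⇒sat w (φ ∨f ψ) (inj₂ n) = inj₂ (msat-translate⇒sat w ψ n)
  msat-translate⇒sat w (op smile _ φ) (v , wRv , ¬m) =
    v , wRv , λ s → ¬m (sat⇒msat-translate v φ s)
  msat-translate⇒sat w (op frown _ φ) ¬all =
    λ v wRv s → ¬all v wRv (sat⇒msat-translate v φ s)
  msat-translate⇒sat w (op circSmile _ φ) (inj₁ ¬m) =
    inj₁ λ s → ¬m (sat⇒msat-translate w φ s)
  msat-translate⇒sat w (op circSmile _ φ) (inj₂ all) =
    inj₂ λ v wRv → msat-translate⇒sat v φ (all v wRv)
  msat-translate⇒sat w (op circFrown _ φ) (inj₁ m) = inj₁ (msat-translate⇒sat w φ m)
  msat-translate⇒sat w (op circFrown _ φ) (inj₂ ¬all) =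
    inj₂ λ v wRv s → ¬all v wRv (sat⇒msat-translate v φ s)
  msat-translate⇒sat w (op bulletSmile _ φ) (m , v , wRv , ¬m) =
    msat-translate⇒sat w φ m , v , wRv , λ s → ¬m (sat⇒msat-translate v φ s)
  msat-translate⇒sat w (op bulletFrown _ φ) (¬m , v , wRv , m) =
    (λ s → ¬m (sat⇒msat-translate w φ s)) , v , wRv , msat-translate⇒sat v φ m

  module _ {Δ : Form K Λ → Set} where

    refutes-origins⇒msat : ∀ u {Γ : List (MForm K)}
      (Γ∈ : All (NegatedTranslations Δ) Γ) →
      All (λ φ → ¬ sat M u φ) (origins Γ∈) → All (msat M u) Γ
    refutes-origins⇒msat u [] [] = []
    refutes-origins⇒msat u ((φ , _ , refl) ∷ Γ∈) (¬s ∷ ¬ss) =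
      (λ m → ¬s (msat-translate⇒sat u φ m)) ∷ refutes-origins⇒msat u Γ∈ ¬ss

  finRefutable⇒finSatisfiable-negatedTranslations : (U : W → Set) (Δ : Form K Λ → Set) →
    FinRefutable M (sat M) U Δ → FinSatisfiable M (msat M) U (NegatedTranslations Δ)
  finRefutable⇒finSatisfiable-negatedTranslations U Δ finRefutable Γ Γ∈
    with finRefutable (origins Γ∈) (origins⊆Δ Γ∈)
  ... | u , u∈U , ¬ss = u , u∈U , refutes-origins⇒msat u Γ∈ ¬ss

  satisfiable-negatedTranslations⇒refutable : (U : W → Set) (Δ : Form K Λ → Set) →
    Satisfiable M (msat M) U (NegatedTranslations Δ) → Refutable M (sat M) U Δ
  satisfiable-negatedTranslations⇒refutable U Δ (u , u∈U , ms) =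
    u , u∈U , λ φ φ∈Δ s →
      ms (neg (translate φ)) (φ , φ∈Δ , refl) (sat⇒msat-translate u φ s)

lemma6p6 : {K : Set} (Λ : SimType) (M : Model K) → ModallySaturated M →
    (w : Model.W M) (Δ : Form K Λ → Set) →
    FinRefutable M (sat M) (Model.R M w) Δ → Refutable M (sat M) (Model.R M w) Δ
lemma6p6 Λ M saturated w Δ finRefutable =
  satisfiable-negatedTranslations⇒refutable M (Model.R M w) Δ
    (saturated w (NegatedTranslations Δ)
      (finRefutable⇒finSatisfiable-negatedTranslations M (Model.R M w) Δ finRefutable))
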